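{- Let $\mathcal E=\{V,U_1,U_0\}$ and $m,n\ge0$. Then $D(n,m)=|\mathcal F_{\mathcal E}(m-n,n)|$ and $S(n)=|\mathcal P_{\mathcal E}(1,n)|=|\mathcal P_{\mathcal E}(0,n)|$.
   Context: Steps: $V=(0,-1)$ and $S_k=(1,k)$; $U_k=S_k$ for $k\ge0$. For a set of steps $\mathcal S$, an $\mathcal S$-path is a finite (possibly empty) sequence of steps from $\mathcal S$ starting at $(0,0)$. $\mathcal F_{\mathcal S}(m,n)$ is the set of $\mathcal S$-paths ending at $(n,-m)$; $\mathcal P_{\mathcal S}(m,n)$ is the subset of those all of whose points except possibly the last lie on or above the $x$-axis. $D(n,k)$ (Delannoy number) is the number of lattice paths from $(0,0)$ to $(n,k)$ with steps $(1,0)$, $(0,1)$, $(1,1)$; $S(n)$ (large Schröder number) is the number of such paths from $(0,0)$ to $(n,n)$ that never go below the line $y=x$. -}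

module Defs where

open import Data.Nat using (ℕ; zero; suc) renaming (_+_ to _+ℕ_; _≤ᵇ_ to _≤ᵇ_)
open import Data.Bool using (if_then_else_)
open import Data.Integer using (ℤ; +_; -_; _+_; _≤_)
open import Data.Product using (Σ; _×_; _,_)
open import Data.List using (List; []; _∷_)
open import Data.Unit using (⊤)
open import Relation.Binary.PropositionalEquality using (_≡_)

-- Delannoy numbers D(n,k): number of lattice paths (0,0) → (n,k) with
-- steps (1,0), (0,1), (1,1); defined by decomposing on the last step.

delannoy : ℕ → ℕ → ℕ
delannoy zero    k       = 1
delannoy (suc n) zero    = 1
delannoy (suc n) (suc k) = delannoy n (suc k) +ℕ delannoy (suc n) k +ℕ delannoy n k

-- schröderCount x y : number of lattice paths (0,0) → (x,y) with steps
-- (1,0), (0,1), (1,1) all of whose points satisfy y ≥ x (decomposition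
-- on the last step; zero if the endpoint itself is below y = x).
schröderCount : ℕ → ℕ → ℕ
schröderCount zero    zero    = 1
schröderCount zero    (suc y) = schröderCount zero y
schröderCount (suc x) zero    = 0
schröderCount (suc x) (suc y) =
  if x ≤ᵇ y
  then schröderCount x (suc y) +ℕ schröderCount (suc x) y +ℕ schröderCount x y
  else 0

schröder : ℕ → ℕ
schröder n = schröderCount n n

data EStep : Set where
  V U₁ U₀ : EStep

dx : EStep → ℤ
dx V  = + 0
dx U₁ = + 1
dx U₀ = + 1

dy : EStep → ℤ
dy V  = - (+ 1)
dy U₁ = + 1
dy U₀ = + 0

EPath : Set
EPath = List EStep

endFrom : ℤ × ℤ → EPath → ℤ × ℤ
endFrom p             []      = p
endFrom (x , y)       (s ∷ w) = endFrom (x + dx s , y + dy s) w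

endpoint : EPath → ℤ × ℤ
endpoint = endFrom (+ 0 , + 0)

-- All points of the path (started at height y), except possibly the last,
-- lie on or above the x-axis.  (The points other than the last one are
-- exactly the starting points of the steps.)
aboveExceptLastFrom : ℤ → EPath → Set
aboveExceptLastFrom y []      = ⊤
aboveExceptLastFrom y (s ∷ w) = (+ 0 ≤ y) × aboveExceptLastFrom (y + dy s) w

aboveExceptLast : EPath → Set
aboveExceptLast = aboveExceptLastFrom (+ 0)

-- F_E(m,n): E-paths ending at (n,-m)   (m an integer, since m-n may be negative)
F-E : ℤ → ℕ → Set
F-E m n = Σ EPath λ w → endpoint w ≡ (+ n , - m)

P-E : ℤ → ℕ → Set
P-E m n = Σ EPath λ w → (endpoint w ≡ (+ n , - m)) × aboveExceptLast w

-- Walking along an E-path of width n that ends at height -k, let x be the number of U-steps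
-- and y the number of V- and U₀-steps still to come. Then (x , y) walks in ℕ² from (n , n + k)
-- to the origin, V, U₁ and U₀ moving it by (0 , -1), (-1 , 0) and (-1 , -1), and the current
-- height is y - x - k. So F(m - n, n) is the set of all such walks from (n , m), and P(d, n)
-- for d = 0, 1 is the set of walks from (n , n + d) all of whose points but the last satisfy
-- d + x ≤ y. Splitting off the first step of a walk yields exactly the recurrences defining
-- D and schröderCount, so both counts follow by induction on the starting point.

{-# OPTIONS --safe #-}
module Submission where

open import Defs
open import Data.Nat using (ℕ)
open import Data.Integer using (+_; _-_)
open import Data.Fin using (Fin)
open import Data.Product using (_×_)
open import Function.Bundles using (_↔_)

open import Axiom.UniquenessOfIdentityProofs using (module Decidable⇒UIP)
open import Data.Bool using (Bool; true; false; T; if_then_else_)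
open import Data.Bool.Properties using (T-irrelevant)
open import Data.Fin.Properties using (+↔⊎; 1↔⊤)
open import Data.Integer as ℤ using (ℤ; -_)
import Data.Integer.Properties as ℤ
open import Data.Integer.Tactic.RingSolver using (solve-∀)
open import Data.List using ([]; _∷_)
open import Data.Nat as ℕ using (zero; suc; _+_; _≤ᵇ_; _<ᵇ_)
import Data.Nat.Properties as ℕ
open import Data.Product using (Σ; _,_; proj₁; proj₂)
open import Data.Product.Algebra using (×-cong)
open import Data.Product.Function.Dependent.Propositional using (Σ-↔)
open import Data.Product.Properties using (≡-dec)
open import Data.Sum using (_⊎_; inj₁; inj₂)
open import Data.Sum.Function.Propositional using (_⊎-↔_)
open import Data.Unit using (⊤; tt)
open import Function.Bundles using (mk↔ₛ′)
open import Function.Properties.Inverse using (↔-refl; ↔-sym; ↔-trans)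
open import Relation.Binary.PropositionalEquality
  using (_≡_; refl; sym; trans; cong; cong₂; subst₂; module ≡-Reasoning)
open import Relation.Nullary.Irrelevant using (Irrelevant)

private
  variable
    A B : Set
    m n x y : ℕ
    b t : ℤ
    w : EPath

irrelevant⇒↔ : Irrelevant A → Irrelevant B → (A → B) → (B → A) → A ↔ B
irrelevant⇒↔ irrA irrB f g = mk↔ₛ′ f g (λ _ → irrB _ _) (λ _ → irrA _ _)

×-irrelevant : Irrelevant A → Irrelevant B → Irrelevant (A × B)
×-irrelevant irrA irrB (a , b) (a′ , b′) = cong₂ _,_ (irrA a a′) (irrB b b′)

⊎-↔-+ : A ↔ Fin m → B ↔ Fin n → (A ⊎ B) ↔ Fin (m + n)
⊎-↔-+ A↔m B↔n = ↔-trans (A↔m ⊎-↔ B↔n) (↔-sym +↔⊎)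

T-false-×-↔ : (T false × A) ↔ Fin 0
T-false-×-↔ = mk↔ₛ′ (λ ()) (λ ()) (λ ()) (λ ())

guarded-↔ : ∀ c → A ↔ Fin n → (T c × A) ↔ Fin (if c then n else 0)
guarded-↔ true  A↔n = ↔-trans (mk↔ₛ′ proj₂ (tt ,_) (λ _ → refl) (λ _ → refl)) A↔n
guarded-↔ false _   = T-false-×-↔

Region : Set
Region = ℕ → ℕ → Bool

data WalkIn (r : Region) : EPath → ℕ → ℕ → Set where
  done   : WalkIn r [] 0 0
  stepV  : T (r x (suc y))       → WalkIn r w x y → WalkIn r (V ∷ w) x (suc y)
  stepU₁ : T (r (suc x) y)       → WalkIn r w x y → WalkIn r (U₁ ∷ w) (suc x) y
  stepU₀ : T (r (suc x) (suc y)) → WalkIn r w x y → WalkIn r (U₀ ∷ w) (suc x) (suc y)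

Walks : Region → ℕ → ℕ → Set
Walks r x y = Σ EPath λ w → WalkIn r w x y

everywhere : Region
everywhere _ _ = true

above : ℕ → Region
above d x y = d + x ≤ᵇ y

private
  variable
    r r′ : Region

walkIn-irrelevant : Irrelevant (WalkIn r w x y)
walkIn-irrelevant done         done           = refl
walkIn-irrelevant (stepV c p)  (stepV c′ p′)  =
  cong₂ stepV (T-irrelevant c c′) (walkIn-irrelevant p p′)
walkIn-irrelevant (stepU₁ c p) (stepU₁ c′ p′) =
  cong₂ stepU₁ (T-irrelevant c c′) (walkIn-irrelevant p p′)
walkIn-irrelevant (stepU₀ c p) (stepU₀ c′ p′) =
  cong₂ stepU₀ (T-irrelevant c c′) (walkIn-irrelevant p p′)

walkIn-mono : (∀ {x y} → T (r x y) → T (r′ x y)) → WalkIn r w x y → WalkIn r′ w x y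
walkIn-mono r⊆r′ done         = done
walkIn-mono r⊆r′ (stepV c p)  = stepV (r⊆r′ c) (walkIn-mono r⊆r′ p)
walkIn-mono r⊆r′ (stepU₁ c p) = stepU₁ (r⊆r′ c) (walkIn-mono r⊆r′ p)
walkIn-mono r⊆r′ (stepU₀ c p) = stepU₀ (r⊆r′ c) (walkIn-mono r⊆r′ p)

walks-0-0 : Walks r 0 0 ↔ ⊤
walks-0-0 = mk↔ₛ′ (λ _ → tt) (λ _ → [] , done) (λ _ → refl) λ { ([] , done) → refl }

walks-0-s : Walks r 0 (suc y) ↔ (T (r 0 (suc y)) × Walks r 0 y)
walks-0-s = mk↔ₛ′
  (λ { (V ∷ w , stepV c p) → c , w , p })
  (λ (c , w , p) → V ∷ w , stepV c p)
  (λ _ → refl)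
  (λ { (V ∷ _ , stepV _ _) → refl })

walks-s-0 : Walks r (suc x) 0 ↔ (T (r (suc x) 0) × Walks r x 0)
walks-s-0 = mk↔ₛ′
  (λ { (U₁ ∷ w , stepU₁ c p) → c , w , p })
  (λ (c , w , p) → U₁ ∷ w , stepU₁ c p)
  (λ _ → refl)
  (λ { (U₁ ∷ _ , stepU₁ _ _) → refl })

walks-s-s : Walks r (suc x) (suc y) ↔
  (T (r (suc x) (suc y)) × ((Walks r x (suc y) ⊎ Walks r (suc x) y) ⊎ Walks r x y))
walks-s-s = mk↔ₛ′
  (λ { (U₁ ∷ w , stepU₁ c p) → c , inj₁ (inj₁ (w , p))
     ; (V  ∷ w , stepV  c p) → c , inj₁ (inj₂ (w , p))
     ; (U₀ ∷ w , stepU₀ c p) → c , inj₂ (w , p) })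
  (λ { (c , inj₁ (inj₁ (w , p))) → U₁ ∷ w , stepU₁ c p
     ; (c , inj₁ (inj₂ (w , p))) → V ∷ w , stepV c p
     ; (c , inj₂ (w , p))        → U₀ ∷ w , stepU₀ c p })
  (λ { (_ , inj₁ (inj₁ _)) → refl
     ; (_ , inj₁ (inj₂ _)) → refl
     ; (_ , inj₂ _)        → refl })
  (λ { (U₁ ∷ _ , stepU₁ _ _) → refl
     ; (V  ∷ _ , stepV  _ _) → refl
     ; (U₀ ∷ _ , stepU₀ _ _) → refl })

delannoy-walks : ∀ x y → Walks everywhere x y ↔ Fin (delannoy x y)
delannoy-walks zero          zero    = ↔-trans walks-0-0 (↔-sym 1↔⊤)
delannoy-walks zero          (suc y) =
  ↔-trans walks-0-s (guarded-↔ true (delannoy-walks zero y))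
delannoy-walks (suc zero)    zero    =
  ↔-trans walks-s-0 (guarded-↔ true (delannoy-walks zero zero))
delannoy-walks (suc (suc x)) zero    =
  ↔-trans walks-s-0 (guarded-↔ true (delannoy-walks (suc x) zero))
delannoy-walks (suc x)       (suc y) = ↔-trans walks-s-s (guarded-↔ true
  (⊎-↔-+ (⊎-↔-+ (delannoy-walks x (suc y)) (delannoy-walks (suc x) y))
          (delannoy-walks x y)))

-- At a point (1 + x , 1 + y + d) the test of above d computes to x <ᵇ suc y,
-- while schröderCount tests x ≤ᵇ y.
guarded-≤ᵇ-↔ : ∀ x y → A ↔ Fin n →
  (T (x <ᵇ suc y) × A) ↔ Fin (if x ≤ᵇ y then n else 0)
guarded-≤ᵇ-↔ zero    y = guarded-↔ true
guarded-≤ᵇ-↔ (suc x) y = guarded-↔ (x <ᵇ y)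

schröder-walks₀ : ∀ x y → Walks (above 0) x y ↔ Fin (schröderCount x y)
schröder-walks₀ zero    zero    = ↔-trans walks-0-0 (↔-sym 1↔⊤)
schröder-walks₀ zero    (suc y) =
  ↔-trans walks-0-s (guarded-↔ true (schröder-walks₀ zero y))
schröder-walks₀ (suc x) zero    = ↔-trans walks-s-0 T-false-×-↔
schröder-walks₀ (suc x) (suc y) = ↔-trans walks-s-s (guarded-≤ᵇ-↔ x y
  (⊎-↔-+ (⊎-↔-+ (schröder-walks₀ x (suc y)) (schröder-walks₀ (suc x) y))
          (schröder-walks₀ x y)))

schröder-walks₁ : ∀ x y → Walks (above 1) x (suc y) ↔ Fin (schröderCount x y)
schröder-walks₁ zero    zero    =
  ↔-trans walks-0-s (guarded-↔ true (↔-trans walks-0-0 (↔-sym 1↔⊤)))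
schröder-walks₁ zero    (suc y) =
  ↔-trans walks-0-s (guarded-↔ true (schröder-walks₁ zero y))
schröder-walks₁ (suc x) zero    = ↔-trans walks-s-s T-false-×-↔
schröder-walks₁ (suc x) (suc y) = ↔-trans walks-s-s (guarded-≤ᵇ-↔ x y
  (⊎-↔-+ (⊎-↔-+ (schröder-walks₁ x (suc y)) (schröder-walks₁ (suc x) y))
          (schröder-walks₁ x y)))

width descent : EPath → ℕ
width []       = 0
width (V ∷ w)  = width w
width (U₁ ∷ w) = suc (width w)
width (U₀ ∷ w) = suc (width w)
descent []       = 0
descent (V ∷ w)  = suc (descent w)
descent (U₁ ∷ w) = descent w
descent (U₀ ∷ w) = suc (descent w)

walk-shape : ∀ w → WalkIn everywhere w (width w) (descent w)
walk-shape []       = done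
walk-shape (V ∷ w)  = stepV tt (walk-shape w)
walk-shape (U₁ ∷ w) = stepU₁ tt (walk-shape w)
walk-shape (U₀ ∷ w) = stepU₀ tt (walk-shape w)

endFrom-step : ∀ a b i j x y →
  ((a ℤ.+ + i) ℤ.+ + x , (b ℤ.+ (+ i - + j)) ℤ.+ (+ x - + y)) ≡
  (a ℤ.+ + (i + x) , b ℤ.+ (+ (i + x) - + (j + y)))
endFrom-step a b i j x y =
  cong₂ _,_ (ℤ.+-assoc a (+ i) (+ x)) (shift b (+ i) (+ j) (+ x) (+ y))
  where
  shift : ∀ b i j x y → (b ℤ.+ (i - j)) ℤ.+ (x - y) ≡ b ℤ.+ ((i ℤ.+ x) - (j ℤ.+ y))
  shift = solve-∀

endFrom-walk : WalkIn r w x y → ∀ a b → endFrom (a , b) w ≡ (a ℤ.+ + x , b ℤ.+ (+ x - + y))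
endFrom-walk done a b = sym (cong₂ _,_ (ℤ.+-identityʳ a) (ℤ.+-identityʳ b))
endFrom-walk {x = x} {y = suc y} (stepV _ p) a b =
  trans (endFrom-walk p _ _) (endFrom-step a b 0 1 x y)
endFrom-walk {x = suc x} {y = y} (stepU₁ _ p) a b =
  trans (endFrom-walk p _ _) (endFrom-step a b 1 0 x y)
endFrom-walk {x = suc x} {y = suc y} (stepU₀ _ p) a b =
  trans (endFrom-walk p _ _) (endFrom-step a b 1 1 x y)

endpoint-walk : WalkIn r w x y → endpoint w ≡ (+ x , + x - + y)
endpoint-walk {x = x} p = trans (endFrom-walk p (+ 0) (+ 0)) (cong (+ x ,_) (ℤ.+-identityˡ _))

plane-injective : (+ m , + m - + n) ≡ (+ x , + x - + y) → m ≡ x × n ≡ y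
plane-injective {m} {n} {x} {y} eq = ℤ.+-injective (cong proj₁ eq) , ℤ.+-injective (begin
  + n                ≡⟨ recover (+ m) (+ n) ⟩
  + m - (+ m - + n)  ≡⟨ cong₂ _-_ (cong proj₁ eq) (cong proj₂ eq) ⟩
  + x - (+ x - + y)  ≡⟨ recover (+ x) (+ y) ⟨
  + y                ∎)
  where
  open ≡-Reasoning
  recover : ∀ i j → j ≡ i - (i - j)
  recover = solve-∀

walkIn-endpoint : t ≡ + x - + y → endpoint w ≡ (+ x , t) → WalkIn everywhere w x y
walkIn-endpoint {w = w} t≡ eq =
  let width≡x , descent≡y = plane-injective
        (trans (sym (endpoint-walk (walk-shape w))) (trans eq (cong (+ _ ,_) t≡)))
  in subst₂ (WalkIn everywhere w) width≡x descent≡y (walk-shape w)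

endpoint-↔-walk : ∀ w → t ≡ + x - + y → (endpoint w ≡ (+ x , t)) ↔ WalkIn everywhere w x y
endpoint-↔-walk w t≡ =
  irrelevant⇒↔ (Decidable⇒UIP.≡-irrelevant (≡-dec ℤ._≟_ ℤ._≟_)) walkIn-irrelevant
    (walkIn-endpoint t≡) (λ p → trans (endpoint-walk p) (cong (+ _ ,_) (sym t≡)))

height : ℕ → ℕ → ℕ → ℤ
height d x y = + y - + (d + x)

height-step : ∀ d i j → b ≡ height d (i + x) (j + y) → b ℤ.+ (+ i - + j) ≡ height d x y
height-step {b} {x} {y} d i j eq =
  trans (cong (ℤ._+ (+ i - + j)) eq) (shift (+ i) (+ j) (+ x) (+ y) (+ d))
  where
  shift : ∀ i j x y d → ((j ℤ.+ y) - (d ℤ.+ (i ℤ.+ x))) ℤ.+ (i - j) ≡ y - (d ℤ.+ x)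
  shift = solve-∀

above⇒0≤ : ∀ d x y → b ≡ height d x y → T (above d x y) → + 0 ℤ.≤ b
above⇒0≤ d x y refl c = ℤ.i≤j⇒0≤j-i (ℤ.+≤+ (ℕ.≤ᵇ⇒≤ (d + x) y c))

0≤⇒above : ∀ d x y → b ≡ height d x y → + 0 ℤ.≤ b → T (above d x y)
0≤⇒above d x y refl 0≤b = ℕ.≤⇒≤ᵇ {d + x} {y} (ℤ.drop‿+≤+ (ℤ.0≤i-j⇒j≤i 0≤b))

aboveExceptLastFrom-irrelevant : ∀ b w → Irrelevant (aboveExceptLastFrom b w)
aboveExceptLastFrom-irrelevant b []      = λ _ _ → refl
aboveExceptLastFrom-irrelevant b (s ∷ w) =
  ×-irrelevant ℤ.≤-irrelevant (aboveExceptLastFrom-irrelevant _ w)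

walkIn-above : ∀ d → b ≡ height d x y →
  WalkIn everywhere w x y → aboveExceptLastFrom b w → WalkIn (above d) w x y
walkIn-above d eq done _ = done
walkIn-above {x = x} {y = suc y} d eq (stepV _ p) (0≤b , q) =
  stepV (0≤⇒above d x (suc y) eq 0≤b) (walkIn-above d (height-step d 0 1 eq) p q)
walkIn-above {x = suc x} {y = y} d eq (stepU₁ _ p) (0≤b , q) =
  stepU₁ (0≤⇒above d (suc x) y eq 0≤b) (walkIn-above d (height-step d 1 0 eq) p q)
walkIn-above {x = suc x} {y = suc y} d eq (stepU₀ _ p) (0≤b , q) =
  stepU₀ (0≤⇒above d (suc x) (suc y) eq 0≤b) (walkIn-above d (height-step d 1 1 eq) p q)

aboveExceptLastFrom-walkIn : ∀ d → b ≡ height d x y →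
  WalkIn (above d) w x y → aboveExceptLastFrom b w
aboveExceptLastFrom-walkIn d eq done = tt
aboveExceptLastFrom-walkIn {x = x} {y = suc y} d eq (stepV c p) =
  above⇒0≤ d x (suc y) eq c , aboveExceptLastFrom-walkIn d (height-step d 0 1 eq) p
aboveExceptLastFrom-walkIn {x = suc x} {y = y} d eq (stepU₁ c p) =
  above⇒0≤ d (suc x) y eq c , aboveExceptLastFrom-walkIn d (height-step d 1 0 eq) p
aboveExceptLastFrom-walkIn {x = suc x} {y = suc y} d eq (stepU₀ c p) =
  above⇒0≤ d (suc x) (suc y) eq c , aboveExceptLastFrom-walkIn d (height-step d 1 1 eq) p

above-↔ : ∀ d → b ≡ height d x y →
  (WalkIn everywhere w x y × aboveExceptLastFrom b w) ↔ WalkIn (above d) w x y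
above-↔ {w = w} d eq =
  irrelevant⇒↔ (×-irrelevant walkIn-irrelevant (aboveExceptLastFrom-irrelevant _ w))
    walkIn-irrelevant
    (λ (p , q) → walkIn-above d eq p q)
    (λ p → walkIn-mono _ p , aboveExceptLastFrom-walkIn d eq p)

paths-↔ : t ≡ + x - + y → Σ EPath (λ w → endpoint w ≡ (+ x , t)) ↔ Walks everywhere x y
paths-↔ t≡ = Σ-↔ ↔-refl λ {w} → endpoint-↔-walk w t≡

pathsAbove-↔ : ∀ d → t ≡ + x - + y → + 0 ≡ height d x y →
  Σ EPath (λ w → (endpoint w ≡ (+ x , t)) × aboveExceptLast w) ↔ Walks (above d) x y
pathsAbove-↔ d t≡ 0≡ =
  Σ-↔ ↔-refl λ {w} → ↔-trans (×-cong (endpoint-↔-walk w t≡) ↔-refl) (above-↔ d 0≡)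

mainTheorem15 : (m n : ℕ) →
    (F-E (+ m - + n) n ↔ Fin (delannoy n m))
    × (P-E (+ 1) n ↔ Fin (schröder n))
    × (P-E (+ 0) n ↔ Fin (schröder n))
mainTheorem15 m n =
    ↔-trans (paths-↔ (neg-minus (+ m) (+ n))) (delannoy-walks n m)
  , ↔-trans (pathsAbove-↔ 1 (minus-suc (+ n)) (sym (ℤ.+-inverseʳ (+ suc n))))
            (schröder-walks₁ n n)
  , ↔-trans (pathsAbove-↔ 0 (sym (ℤ.+-inverseʳ (+ n))) (sym (ℤ.+-inverseʳ (+ n))))
            (schröder-walks₀ n n)
  where
  neg-minus : ∀ i j → - (i - j) ≡ j - i
  neg-minus = solve-∀
  minus-suc : ∀ i → - + 1 ≡ i - (+ 1 ℤ.+ i)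
  minus-suc = solve-∀
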